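{- Let $f:\{0,1\}^n\times\{0,1\}^n\to\{0,1\}^m$ be any function and let $\alpha\in\mathbb{N}$ with $\alpha\le m$. Then there exist two (jointly distributed) random variables $X$ and $Y$ taking values in $\{0,1\}^n$ such that $$H_\infty(X)\ge n-\alpha,\quad H_\infty(Y)\ge n-\alpha,\quad H_\infty(X,Y)\ge 2n-\alpha,\quad H_\infty(f(X,Y))\le m-\alpha.$$
   Context: For a random variable $Z$ with finite range, the min-entropy is $H_\infty(Z)=\min_{a:\Pr[Z=a]>0}\log_2(1/\Pr[Z=a])$; $H_\infty(X,Y)$ is the min-entropy of the pair $(X,Y)$. -}

module Defs where

open import Data.Bool using (Bool; false; true)
open import Data.Nat using (ℕ; _^_)
open import Data.Integer using (+_)
open import Data.Rational using (ℚ; 0ℚ; 1ℚ; _+_; _*_; _≤_; _/_)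
open import Data.List using (List; []; _∷_; map; concatMap; foldr)
open import Data.Vec using (Vec; []; _∷_)
open import Data.Vec.Properties using (≡-dec)
import Data.Bool.Properties as BoolP
open import Data.Product using (Σ; _×_; _,_)
open import Relation.Binary.PropositionalEquality using (_≡_)
open import Relation.Nullary using (yes; no)

Bits : ℕ → Set
Bits n = Vec Bool n

allBits : (n : ℕ) → List (Bits n)
allBits ℕ.zero    = [] ∷ []
allBits (ℕ.suc n) = concatMap (λ v → (false ∷ v) ∷ (true ∷ v) ∷ []) (allBits n)

sumℚ : List ℚ → ℚ
sumℚ = foldr _+_ 0ℚ

Σbits : (n : ℕ) → (Bits n → ℚ) → ℚ
Σbits n g = sumℚ (map g (allBits n))

ℕ→ℚ : ℕ → ℚ
ℕ→ℚ k = + k / 1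

2^ : ℕ → ℚ
2^ k = ℕ→ℚ (2 ^ k)

record JointDist (n : ℕ) : Set where
  field
    pmf      : Bits n → Bits n → ℚ
    nonneg   : ∀ x y → 0ℚ ≤ pmf x y
    total    : Σbits n (λ x → Σbits n (λ y → pmf x y)) ≡ 1ℚ
open JointDist public

PrX : ∀ {n} → JointDist n → Bits n → ℚ
PrX {n} D a = Σbits n (λ y → pmf D a y)

PrY : ∀ {n} → JointDist n → Bits n → ℚ
PrY {n} D b = Σbits n (λ x → pmf D x b)

PrXY : ∀ {n} → JointDist n → Bits n × Bits n → ℚ
PrXY D (a , b) = pmf D a b

PrF : ∀ {n m} → (Bits n → Bits n → Bits m) → JointDist n → Bits m → ℚ
PrF {n} f D c = Σbits n (λ x → Σbits n (λ y → indic x y))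
  where
  indic : Bits n → Bits n → ℚ
  indic x y with ≡-dec BoolP._≟_ (f x y) c
  ... | yes _ = pmf D x y
  ... | no  _ = 0ℚ

-- Since
-- H∞(Z) = min_{a : p a > 0} log₂ (1 / p a), we have, for natural t, α:
--   H∞(Z) ≥ t - α  ⇔  ∀ a, p a ≤ 2^(α - t)  ⇔  ∀ a, p a * 2^t ≤ 2^α
MinEntropy≥ : {A : Set} → (A → ℚ) → (t α : ℕ) → Set
MinEntropy≥ {A} p t α = ∀ (a : A) → p a * 2^ t ≤ 2^ α

--   H∞(Z) ≤ t - α  ⇔  ∃ a with p a > 0 and p a ≥ 2^(α - t)
--                  ⇔  ∃ a, 2^α ≤ p a * 2^t   (as 2^(α - t) > 0)
MinEntropy≤ : {A : Set} → (A → ℚ) → (t α : ℕ) → Set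
MinEntropy≤ {A} p t α = Σ A (λ a → 2^ α ≤ p a * 2^ t)

{-# OPTIONS --safe #-}
module Submission where

-- By the pigeonhole principle some α-bit string p is the prefix of f x y for at
-- least 2^(2n-α) of the pairs (x , y); let (X , Y) be uniform on this set S.
-- A value of X or of Y is taken on at most 2^n points of S and a value of (X , Y)
-- on one, which gives the three lower bounds. On S the remaining m - α bits of
-- f (X , Y) take at most 2^(m-α) values, so by pigeonhole again one value of
-- f (X , Y) has probability at least 2^(α-m).

open import Defs
open import Data.Nat using (ℕ; zero; suc; _+_; _*_; _^_; _≤_; _<_; z≤n; s≤s; NonZero; >-nonZero)
open import Data.Product using (Σ; _×_; ∃-syntax; _,_; proj₁; proj₂; uncurry)

open import Algebra.Properties.CommutativeSemigroup using (interchange; x∙yz≈y∙xz)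
open import Data.Bool using (Bool; false; true)
import Data.Bool.Properties as Bool
open import Data.Empty using (⊥-elim)
import Data.Integer as ℤ
import Data.Integer.Properties as ℤₚ
open import Data.List as List using (List; []; _∷_; map; length; cartesianProduct)
import Data.List.Properties as Listₚ
open import Data.Nat.ListAction using (sum)
open import Data.Nat.ListAction.Properties using (sum-++)
import Data.Nat.Properties as ℕₚ
open import Data.Rational as ℚ using (ℚ; 0ℚ; 1ℚ; toℚᵘ; fromℚᵘ; 1/_)
import Data.Rational.Properties as ℚₚ
open import Data.Rational.Unnormalised as ℚᵘ using (ℚᵘ; mkℚᵘ; *≡*; *≤*)
import Data.Rational.Unnormalised.Properties as ℚᵘₚ
open import Data.Sum using (inj₁; inj₂)
open import Data.Vec as Vec using ([]; _∷_; head; tail; take; drop; splitAt)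
open import Data.Vec.Properties using (≡-dec)
open import Function using (_∘_)
open import Relation.Nullary using (yes; no)
open import Relation.Binary.PropositionalEquality

fromℚᵘ-homo-+ : ∀ p q → fromℚᵘ (p ℚᵘ.+ q) ≡ fromℚᵘ p ℚ.+ fromℚᵘ q
fromℚᵘ-homo-+ p q = ℚₚ.toℚᵘ-injective (begin
  toℚᵘ (fromℚᵘ (p ℚᵘ.+ q))              ≈⟨ ℚₚ.toℚᵘ-fromℚᵘ (p ℚᵘ.+ q) ⟩
  p ℚᵘ.+ q                              ≈⟨ ℚᵘₚ.+-cong (ℚᵘₚ.≃-sym (ℚₚ.toℚᵘ-fromℚᵘ p))
                                                      (ℚᵘₚ.≃-sym (ℚₚ.toℚᵘ-fromℚᵘ q)) ⟩
  toℚᵘ (fromℚᵘ p) ℚᵘ.+ toℚᵘ (fromℚᵘ q)  ≈⟨ ℚᵘₚ.≃-sym (ℚₚ.toℚᵘ-homo-+ (fromℚᵘ p) (fromℚᵘ q)) ⟩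
  toℚᵘ (fromℚᵘ p ℚ.+ fromℚᵘ q)          ∎)
  where open ℚᵘₚ.≃-Reasoning

fromℚᵘ-homo-* : ∀ p q → fromℚᵘ (p ℚᵘ.* q) ≡ fromℚᵘ p ℚ.* fromℚᵘ q
fromℚᵘ-homo-* p q = ℚₚ.toℚᵘ-injective (begin
  toℚᵘ (fromℚᵘ (p ℚᵘ.* q))              ≈⟨ ℚₚ.toℚᵘ-fromℚᵘ (p ℚᵘ.* q) ⟩
  p ℚᵘ.* q                              ≈⟨ ℚᵘₚ.*-cong (ℚᵘₚ.≃-sym (ℚₚ.toℚᵘ-fromℚᵘ p))
                                                      (ℚᵘₚ.≃-sym (ℚₚ.toℚᵘ-fromℚᵘ q)) ⟩
  toℚᵘ (fromℚᵘ p) ℚᵘ.* toℚᵘ (fromℚᵘ q)  ≈⟨ ℚᵘₚ.≃-sym (ℚₚ.toℚᵘ-homo-* (fromℚᵘ p) (fromℚᵘ q)) ⟩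
  toℚᵘ (fromℚᵘ p ℚ.* fromℚᵘ q)          ∎)
  where open ℚᵘₚ.≃-Reasoning

fromℚᵘ-mono-≤ : ∀ {p q} → p ℚᵘ.≤ q → fromℚᵘ p ℚ.≤ fromℚᵘ q
fromℚᵘ-mono-≤ {p} {q} p≤q = ℚₚ.toℚᵘ-cancel-≤
  (ℚᵘₚ.≤-respˡ-≃ (ℚᵘₚ.≃-sym (ℚₚ.toℚᵘ-fromℚᵘ p))
    (ℚᵘₚ.≤-respʳ-≃ (ℚᵘₚ.≃-sym (ℚₚ.toℚᵘ-fromℚᵘ q)) p≤q))

-- ℕ→ℚ k reduces to fromℚᵘ (ι k), so ℕ→ℚ computes like an unnormalised fraction.
private
  ι : ℕ → ℚᵘ
  ι k = mkℚᵘ (ℤ.+ k) 0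

ℕ→ℚ-+ : ∀ a b → ℕ→ℚ (a + b) ≡ ℕ→ℚ a ℚ.+ ℕ→ℚ b
ℕ→ℚ-+ a b = trans (ℚₚ.fromℚᵘ-cong ι-+) (fromℚᵘ-homo-+ (ι a) (ι b))
  where
  ι-+ : ι (a + b) ℚᵘ.≃ ι a ℚᵘ.+ ι b
  ι-+ = *≡* (cong (ℤ._* ℤ.+ 1) (trans (ℤₚ.pos-+ a b)
          (sym (cong₂ ℤ._+_ (ℤₚ.*-identityʳ (ℤ.+ a)) (ℤₚ.*-identityʳ (ℤ.+ b))))))

ℕ→ℚ-* : ∀ a b → ℕ→ℚ (a * b) ≡ ℕ→ℚ a ℚ.* ℕ→ℚ b
ℕ→ℚ-* a b = trans (ℚₚ.fromℚᵘ-cong ι-*) (fromℚᵘ-homo-* (ι a) (ι b))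
  where
  ι-* : ι (a * b) ℚᵘ.≃ ι a ℚᵘ.* ι b
  ι-* = *≡* (cong (ℤ._* ℤ.+ 1) (ℤₚ.pos-* a b))

ℕ→ℚ-mono-≤ : ∀ {a b} → a ≤ b → ℕ→ℚ a ℚ.≤ ℕ→ℚ b
ℕ→ℚ-mono-≤ {a} {b} a≤b = fromℚᵘ-mono-≤ {ι a} {ι b} (*≤* (ℤₚ.*-monoʳ-≤-nonNeg (ℤ.+ 1) (ℤ.+≤+ a≤b)))

ℕ→ℚ-nonNegative : ∀ k → ℚ.NonNegative (ℕ→ℚ k)
ℕ→ℚ-nonNegative k = ℚₚ.normalize-nonNeg k 1

ℕ→ℚ-positive : ∀ k .{{_ : NonZero k}} → ℚ.Positive (ℕ→ℚ k)
ℕ→ℚ-positive k = ℚₚ.normalize-pos k 1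

∑ : {A : Set} → List A → (A → ℕ) → ℕ
∑ l h = sum (map h l)

module _ {A : Set} where

  ∑-cong : ∀ (l : List A) {g h : A → ℕ} → (∀ a → g a ≡ h a) → ∑ l g ≡ ∑ l h
  ∑-cong l g≗h = cong sum (Listₚ.map-cong g≗h l)

  ∑-+ : ∀ (l : List A) (g h : A → ℕ) → ∑ l (λ a → g a + h a) ≡ ∑ l g + ∑ l h
  ∑-+ []      g h = refl
  ∑-+ (a ∷ l) g h = trans (cong ((g a + h a) +_) (∑-+ l g h))
                          (interchange ℕₚ.+-commutativeSemigroup (g a) (h a) (∑ l g) (∑ l h))

  ∑-mono-≤ : ∀ (l : List A) {g h : A → ℕ} → (∀ a → g a ≤ h a) → ∑ l g ≤ ∑ l h
  ∑-mono-≤ []      g≤h = z≤n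
  ∑-mono-≤ (a ∷ l) g≤h = ℕₚ.+-mono-≤ (g≤h a) (∑-mono-≤ l g≤h)

  ∑-const : ∀ (l : List A) c → ∑ l (λ _ → c) ≡ length l * c
  ∑-const []      c = refl
  ∑-const (a ∷ l) c = cong (c +_) (∑-const l c)

  ∑-++ : ∀ (xs ys : List A) (h : A → ℕ) → ∑ (xs List.++ ys) h ≡ ∑ xs h + ∑ ys h
  ∑-++ xs ys h = trans (cong sum (Listₚ.map-++ h xs ys)) (sum-++ (map h xs) (map h ys))

  ∑-map : ∀ {B : Set} (f : B → A) (l : List B) (h : A → ℕ) → ∑ (map f l) h ≡ ∑ l (h ∘ f)
  ∑-map f l h = cong sum (sym (Listₚ.map-∘ l))

∑-cartesianProduct : ∀ {A B : Set} (xs : List A) (ys : List B) (h : A × B → ℕ) →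
                     ∑ (cartesianProduct xs ys) h ≡ ∑ xs (λ x → ∑ ys (λ y → h (x , y)))
∑-cartesianProduct []       ys h = refl
∑-cartesianProduct (x ∷ xs) ys h = begin
  ∑ (map (x ,_) ys List.++ cartesianProduct xs ys) h   ≡⟨ ∑-++ (map (x ,_) ys) _ h ⟩
  ∑ (map (x ,_) ys) h + ∑ (cartesianProduct xs ys) h  ≡⟨ cong₂ _+_ (∑-map (x ,_) ys h)
                                                                   (∑-cartesianProduct xs ys h) ⟩
  ∑ ys (λ y → h (x , y)) + ∑ xs (λ x → ∑ ys (λ y → h (x , y))) ∎
  where open ≡-Reasoning

length-cartesianProduct : ∀ {A B : Set} (xs : List A) (ys : List B) →
                          length (cartesianProduct xs ys) ≡ length xs * length ys
length-cartesianProduct []       ys = refl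
length-cartesianProduct (x ∷ xs) ys = begin
  length (map (x ,_) ys List.++ cartesianProduct xs ys)   ≡⟨ Listₚ.length-++ (map (x ,_) ys) ⟩
  length (map (x ,_) ys) + length (cartesianProduct xs ys) ≡⟨ cong₂ _+_ (Listₚ.length-map (x ,_) ys)
                                                                      (length-cartesianProduct xs ys) ⟩
  length ys + length xs * length ys ∎
  where open ≡-Reasoning

sumℚ-ℕ→ℚ-* : ∀ {A : Set} (l : List A) (h : A → ℕ) c →
             sumℚ (map (λ a → ℕ→ℚ (h a) ℚ.* c) l) ≡ ℕ→ℚ (∑ l h) ℚ.* c
sumℚ-ℕ→ℚ-* []      h c = sym (ℚₚ.*-zeroˡ c)
sumℚ-ℕ→ℚ-* (a ∷ l) h c = begin
  ℕ→ℚ (h a) ℚ.* c ℚ.+ sumℚ (map (λ a → ℕ→ℚ (h a) ℚ.* c) l)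
    ≡⟨ cong (ℕ→ℚ (h a) ℚ.* c ℚ.+_) (sumℚ-ℕ→ℚ-* l h c) ⟩
  ℕ→ℚ (h a) ℚ.* c ℚ.+ ℕ→ℚ (∑ l h) ℚ.* c
    ≡⟨ ℚₚ.*-distribʳ-+ c (ℕ→ℚ (h a)) (ℕ→ℚ (∑ l h)) ⟨
  (ℕ→ℚ (h a) ℚ.+ ℕ→ℚ (∑ l h)) ℚ.* c
    ≡⟨ cong (ℚ._* c) (ℕ→ℚ-+ (h a) (∑ l h)) ⟨
  ℕ→ℚ (h a + ∑ l h) ℚ.* c
    ∎
  where open ≡-Reasoning

length-allBits : ∀ n → length (allBits n) ≡ 2 ^ n
length-allBits zero    = refl
length-allBits (suc n) = trans (length-doubled (allBits n)) (cong (2 *_) (length-allBits n))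
  where
  length-doubled : ∀ (l : List (Bits n)) →
                   length (List.concatMap (λ v → (false ∷ v) ∷ (true ∷ v) ∷ []) l) ≡ 2 * length l
  length-doubled []      = refl
  length-doubled (v ∷ l) = trans (cong (suc ∘ suc) (length-doubled l)) (sym (ℕₚ.*-suc 2 (length l)))

δᵇ : Bool → Bool → ℕ
δᵇ false false = 1
δᵇ true  true  = 1
δᵇ _     _     = 0

δᵇ-refl : ∀ a → δᵇ a a ≡ 1
δᵇ-refl false = refl
δᵇ-refl true  = refl

δᵇ-≢ : ∀ {a b} → a ≢ b → δᵇ a b ≡ 0
δᵇ-≢ {false} {false} a≢b = ⊥-elim (a≢b refl)
δᵇ-≢ {true}  {true}  a≢b = ⊥-elim (a≢b refl)
δᵇ-≢ {false} {true}  _   = refl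
δᵇ-≢ {true}  {false} _   = refl

δᵇ≤1 : ∀ a b → δᵇ a b ≤ 1
δᵇ≤1 false false = ℕₚ.≤-refl
δᵇ≤1 true  true  = ℕₚ.≤-refl
δᵇ≤1 false true  = z≤n
δᵇ≤1 true  false = z≤n

δᵇ-false+true : ∀ a → δᵇ a false + δᵇ a true ≡ 1
δᵇ-false+true false = refl
δᵇ-false+true true  = refl

-- Recursion on the second argument only, so that δ u (b ∷ v) unfolds for any u.
δ : ∀ {r} → Bits r → Bits r → ℕ
δ u []      = 1
δ u (b ∷ v) = δᵇ (head u) b * δ (tail u) v

δ≤1 : ∀ {r} (u v : Bits r) → δ u v ≤ 1
δ≤1 u []      = ℕₚ.≤-refl
δ≤1 u (b ∷ v) = ℕₚ.*-mono-≤ (δᵇ≤1 (head u) b) (δ≤1 (tail u) v)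

δ-refl : ∀ {r} (u : Bits r) → δ u u ≡ 1
δ-refl []      = refl
δ-refl (a ∷ u) = cong₂ _*_ (δᵇ-refl a) (δ-refl u)

δ-≢ : ∀ {r} (u v : Bits r) → u ≢ v → δ u v ≡ 0
δ-≢ []      []      u≢v = ⊥-elim (u≢v refl)
δ-≢ (a ∷ u) (b ∷ v) u≢v with a Bool.≟ b
... | yes refl = trans (cong (δᵇ a a *_) (δ-≢ u v (u≢v ∘ cong (a ∷_)))) (ℕₚ.*-zeroʳ (δᵇ a a))
... | no  a≢b  = cong (_* δ u v) (δᵇ-≢ a≢b)

δ-++ : ∀ {r s} (u₁ v₁ : Bits r) (u₂ v₂ : Bits s) →
       δ (u₁ Vec.++ u₂) (v₁ Vec.++ v₂) ≡ δ u₁ v₁ * δ u₂ v₂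
δ-++ []       []       u₂ v₂ = sym (ℕₚ.*-identityˡ (δ u₂ v₂))
δ-++ (a ∷ u₁) (b ∷ v₁) u₂ v₂ = trans (cong (δᵇ a b *_) (δ-++ u₁ v₁ u₂ v₂))
                                     (sym (ℕₚ.*-assoc (δᵇ a b) (δ u₁ v₁) (δ u₂ v₂)))

δ-take-drop : ∀ r {s} (u : Bits (r + s)) (v₁ : Bits r) (v₂ : Bits s) →
              δ u (v₁ Vec.++ v₂) ≡ δ (take r u) v₁ * δ (drop r u) v₂
δ-take-drop r u v₁ v₂ = trans (cong (λ u → δ u (v₁ Vec.++ v₂)) (proj₂ (proj₂ (splitAt r u))))
                              (δ-++ (take r u) v₁ (drop r u) v₂)

δ-idem : ∀ {r} (u v : Bits r) → δ u v * δ u v ≡ δ u v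
δ-idem u v with δ u v | δ≤1 u v
... | 0           | _      = refl
... | 1           | _      = refl
... | suc (suc _) | s≤s ()

∑-allBits-≤ : ∀ n {h : Bits n → ℕ} → (∀ v → h v ≤ 1) → ∑ (allBits n) h ≤ 2 ^ n
∑-allBits-≤ n h≤1 = ℕₚ.≤-trans (∑-mono-≤ (allBits n) h≤1)
  (ℕₚ.≤-reflexive (trans (∑-const (allBits n) 1) (trans (ℕₚ.*-identityʳ _) (length-allBits n))))

pairs : ∀ n → List (Bits n × Bits n)
pairs n = cartesianProduct (allBits n) (allBits n)

length-pairs : ∀ n → length (pairs n) ≡ 2 ^ n * 2 ^ n
length-pairs n = trans (length-cartesianProduct (allBits n) (allBits n))
                       (cong₂ _*_ (length-allBits n) (length-allBits n))

-- Weighted pigeonhole principle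

heavierBit : ∀ (x : Bool → ℕ) → ∃[ b ] x false + x true ≤ 2 * x b
heavierBit x with ℕₚ.≤-total (x false) (x true)
... | inj₁ f≤t = true  , ℕₚ.+-mono-≤ f≤t (ℕₚ.m≤m+n (x true) 0)
... | inj₂ t≤f = false , ℕₚ.+-monoʳ-≤ (x false) (ℕₚ.≤-trans t≤f (ℕₚ.m≤m+n (x false) 0))

module _ {A : Set} (l : List A) where

  restrictHead : ∀ {r} → (A → Bits (suc r)) → (A → ℕ) → Bool → A → ℕ
  restrictHead g w b a = w a * δᵇ (head (g a)) b

  ∑-restrictHead : ∀ {r} (g : A → Bits (suc r)) (w : A → ℕ) →
                   ∑ l w ≡ ∑ l (restrictHead g w false) + ∑ l (restrictHead g w true)
  ∑-restrictHead g w =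
    trans (∑-cong l split) (∑-+ l (restrictHead g w false) (restrictHead g w true))
    where
    split : ∀ a → w a ≡ restrictHead g w false a + restrictHead g w true a
    split a = begin
      w a                                                   ≡⟨ ℕₚ.*-identityʳ (w a) ⟨
      w a * 1                                               ≡⟨ cong (w a *_) (δᵇ-false+true (head (g a))) ⟨
      w a * (δᵇ (head (g a)) false + δᵇ (head (g a)) true)  ≡⟨ ℕₚ.*-distribˡ-+ (w a) _ _ ⟩
      restrictHead g w false a + restrictHead g w true a    ∎
      where open ≡-Reasoning

  pigeonhole : ∀ r (g : A → Bits r) (w : A → ℕ) →
               ∃[ c ] ∑ l w ≤ ∑ l (λ a → w a * δ (g a) c) * 2 ^ r
  pigeonhole zero g w = [] , ℕₚ.≤-reflexive (sym (begin
    ∑ l (λ a → w a * 1) * 1  ≡⟨ ℕₚ.*-identityʳ _ ⟩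
    ∑ l (λ a → w a * 1)      ≡⟨ ∑-cong l (λ a → ℕₚ.*-identityʳ (w a)) ⟩
    ∑ l w                    ∎))
    where open ≡-Reasoning
  pigeonhole (suc r) g w with heavierBit (λ b → ∑ l (restrictHead g w b))
  ... | b , heavy with pigeonhole r (tail ∘ g) (restrictHead g w b)
  ... | c , ih = b ∷ c , (begin
    ∑ l w
      ≡⟨ ∑-restrictHead g w ⟩
    ∑ l (restrictHead g w false) + ∑ l (restrictHead g w true)
      ≤⟨ heavy ⟩
    2 * ∑ l (restrictHead g w b)
      ≤⟨ ℕₚ.*-monoʳ-≤ 2 ih ⟩
    2 * (∑ l (λ a → restrictHead g w b a * δ (tail (g a)) c) * 2 ^ r)
      ≡⟨ cong (λ S → 2 * (S * 2 ^ r)) (∑-cong l assoc) ⟩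
    2 * (F * 2 ^ r)
      ≡⟨ x∙yz≈y∙xz ℕₚ.*-commutativeSemigroup 2 F (2 ^ r) ⟩
    F * 2 ^ suc r
      ∎)
    where
    open ℕₚ.≤-Reasoning
    F : ℕ
    F = ∑ l (λ a → w a * δ (g a) (b ∷ c))
    assoc : ∀ a → restrictHead g w b a * δ (tail (g a)) c ≡ w a * δ (g a) (b ∷ c)
    assoc a = ℕₚ.*-assoc (w a) (δᵇ (head (g a)) b) (δ (tail (g a)) c)

-- Distributions given by integer weights

Σ² : ∀ {n} → (Bits n → Bits n → ℕ) → ℕ
Σ² {n} w = ∑ (pairs n) (uncurry w)

Σbits²-ℕ→ℚ-* : ∀ n (h : Bits n → Bits n → ℕ) c →
               Σbits n (λ x → Σbits n (λ y → ℕ→ℚ (h x y) ℚ.* c)) ≡ ℕ→ℚ (Σ² h) ℚ.* c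
Σbits²-ℕ→ℚ-* n h c = begin
  sumℚ (map (λ x → sumℚ (map (λ y → ℕ→ℚ (h x y) ℚ.* c) L)) L)
    ≡⟨ cong sumℚ (Listₚ.map-cong (λ x → sumℚ-ℕ→ℚ-* L (h x) c) L) ⟩
  sumℚ (map (λ x → ℕ→ℚ (∑ L (h x)) ℚ.* c) L)
    ≡⟨ sumℚ-ℕ→ℚ-* L (λ x → ∑ L (h x)) c ⟩
  ℕ→ℚ (∑ L (λ x → ∑ L (h x))) ℚ.* c
    ≡⟨ cong (λ S → ℕ→ℚ S ℚ.* c) (∑-cartesianProduct L L (uncurry h)) ⟨
  ℕ→ℚ (Σ² h) ℚ.* c
    ∎
  where
  open ≡-Reasoning
  L : List (Bits n)
  L = allBits n

module Normalised (N : ℕ) .{{_ : NonZero N}} where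

  instance
    N-positive : ℚ.Positive (ℕ→ℚ N)
    N-positive = ℕ→ℚ-positive N

    N-nonZero : ℚ.NonZero (ℕ→ℚ N)
    N-nonZero = ℚₚ.pos⇒nonZero (ℕ→ℚ N)

  ρ : ℚ
  ρ = 1/ ℕ→ℚ N

  ℕ→ℚ-*ρ-nonNeg : ∀ k → 0ℚ ℚ.≤ ℕ→ℚ k ℚ.* ρ
  ℕ→ℚ-*ρ-nonNeg k = ℚₚ.nonNegative⁻¹ _ {{ℚₚ.nonNeg*nonNeg⇒nonNeg
    (ℕ→ℚ k) {{ℕ→ℚ-nonNegative k}} ρ {{ℚₚ.pos⇒nonNeg ρ {{ℚₚ.1/pos⇒pos (ℕ→ℚ N)}}}}}}

  ρ-cancel : ∀ a b → ℕ→ℚ a ℚ.* ρ ℚ.* ℕ→ℚ b ℚ.* ℕ→ℚ N ≡ ℕ→ℚ (a * b)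
  ρ-cancel a b = begin
    ℕ→ℚ a ℚ.* ρ ℚ.* ℕ→ℚ b ℚ.* ℕ→ℚ N    ≡⟨ cong (ℚ._* ℕ→ℚ N) (ℚₚ.*-assoc (ℕ→ℚ a) ρ (ℕ→ℚ b)) ⟩
    ℕ→ℚ a ℚ.* (ρ ℚ.* ℕ→ℚ b) ℚ.* ℕ→ℚ N  ≡⟨ cong (λ q → ℕ→ℚ a ℚ.* q ℚ.* ℕ→ℚ N) (ℚₚ.*-comm ρ (ℕ→ℚ b)) ⟩
    ℕ→ℚ a ℚ.* (ℕ→ℚ b ℚ.* ρ) ℚ.* ℕ→ℚ N  ≡⟨ cong (ℚ._* ℕ→ℚ N) (ℚₚ.*-assoc (ℕ→ℚ a) (ℕ→ℚ b) ρ) ⟨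
    ℕ→ℚ a ℚ.* ℕ→ℚ b ℚ.* ρ ℚ.* ℕ→ℚ N    ≡⟨ ℚₚ.*-assoc (ℕ→ℚ a ℚ.* ℕ→ℚ b) ρ (ℕ→ℚ N) ⟩
    ℕ→ℚ a ℚ.* ℕ→ℚ b ℚ.* (ρ ℚ.* ℕ→ℚ N)  ≡⟨ cong (ℕ→ℚ a ℚ.* ℕ→ℚ b ℚ.*_) (ℚₚ.*-inverseˡ (ℕ→ℚ N)) ⟩
    ℕ→ℚ a ℚ.* ℕ→ℚ b ℚ.* 1ℚ             ≡⟨ ℚₚ.*-identityʳ (ℕ→ℚ a ℚ.* ℕ→ℚ b) ⟩
    ℕ→ℚ a ℚ.* ℕ→ℚ b                    ≡⟨ ℕ→ℚ-* a b ⟨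
    ℕ→ℚ (a * b)                        ∎
    where open ≡-Reasoning

  counts⇒minEntropy≥ : ∀ {A : Set} {p : A → ℚ} (h : A → ℕ) (t α : ℕ) →
                       (∀ a → p a ≡ ℕ→ℚ (h a) ℚ.* ρ) → (∀ a → h a * 2 ^ t ≤ 2 ^ α * N) →
                       MinEntropy≥ p t α
  counts⇒minEntropy≥ {p = p} h t α p≡ bound a = ℚₚ.*-cancelʳ-≤-pos (ℕ→ℚ N) (begin
    p a ℚ.* 2^ t ℚ.* ℕ→ℚ N              ≡⟨ cong (λ q → q ℚ.* 2^ t ℚ.* ℕ→ℚ N) (p≡ a) ⟩
    ℕ→ℚ (h a) ℚ.* ρ ℚ.* 2^ t ℚ.* ℕ→ℚ N  ≡⟨ ρ-cancel (h a) (2 ^ t) ⟩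
    ℕ→ℚ (h a * 2 ^ t)                   ≤⟨ ℕ→ℚ-mono-≤ (bound a) ⟩
    ℕ→ℚ (2 ^ α * N)                     ≡⟨ ℕ→ℚ-* (2 ^ α) N ⟩
    2^ α ℚ.* ℕ→ℚ N                      ∎)
    where open ℚₚ.≤-Reasoning

  count⇒minEntropy≤ : ∀ {A : Set} {p : A → ℚ} (h : A → ℕ) (t α : ℕ) (a : A) →
                      p a ≡ ℕ→ℚ (h a) ℚ.* ρ → 2 ^ α * N ≤ h a * 2 ^ t →
                      MinEntropy≤ p t α
  count⇒minEntropy≤ {p = p} h t α a p≡ bound = a , ℚₚ.*-cancelʳ-≤-pos (ℕ→ℚ N) (begin
    2^ α ℚ.* ℕ→ℚ N                      ≡⟨ ℕ→ℚ-* (2 ^ α) N ⟨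
    ℕ→ℚ (2 ^ α * N)                     ≤⟨ ℕ→ℚ-mono-≤ bound ⟩
    ℕ→ℚ (h a * 2 ^ t)                   ≡⟨ ρ-cancel (h a) (2 ^ t) ⟨
    ℕ→ℚ (h a) ℚ.* ρ ℚ.* 2^ t ℚ.* ℕ→ℚ N  ≡⟨ cong (λ q → q ℚ.* 2^ t ℚ.* ℕ→ℚ N) p≡ ⟨
    p a ℚ.* 2^ t ℚ.* ℕ→ℚ N              ∎)
    where open ℚₚ.≤-Reasoning

module WeightedDistribution {n : ℕ} (w : Bits n → Bits n → ℕ) .{{_ : NonZero (Σ² w)}} where

  open Normalised (Σ² w) public

  dist : JointDist n
  dist = record
    { pmf    = λ x y → ℕ→ℚ (w x y) ℚ.* ρ
    ; nonneg = λ x y → ℕ→ℚ-*ρ-nonNeg (w x y)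
    ; total  = trans (Σbits²-ℕ→ℚ-* n w ρ) (ℚₚ.*-inverseʳ (ℕ→ℚ (Σ² w)))
    }

  PrX-dist : ∀ a → PrX dist a ≡ ℕ→ℚ (∑ (allBits n) (w a)) ℚ.* ρ
  PrX-dist a = sumℚ-ℕ→ℚ-* (allBits n) (w a) ρ

  PrY-dist : ∀ b → PrY dist b ≡ ℕ→ℚ (∑ (allBits n) (λ a → w a b)) ℚ.* ρ
  PrY-dist b = sumℚ-ℕ→ℚ-* (allBits n) (λ a → w a b) ρ

  module _ {m} (f : Bits n → Bits n → Bits m) (c : Bits m) where

    -- The summand of PrF is local to its definition, so its type is left to unification.
    mutual
      PrF-dist : PrF f dist c ≡ ℕ→ℚ (Σ² (λ x y → w x y * δ (f x y) c)) ℚ.* ρ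
      PrF-dist = trans (cong sumℚ (Listₚ.map-cong (λ x → cong sumℚ (Listₚ.map-cong (summand x) L)) L))
                       (Σbits²-ℕ→ℚ-* n (λ x y → w x y * δ (f x y) c) ρ)
        where L : List (Bits n)
              L = allBits n

      summand : ∀ x y → _ ≡ ℕ→ℚ (w x y * δ (f x y) c) ℚ.* ρ
      summand x y with ≡-dec Bool._≟_ (f x y) c
      ... | yes refl = cong (λ k → ℕ→ℚ k ℚ.* ρ) (sym w*δ≡w)
        where
        w*δ≡w : w x y * δ (f x y) (f x y) ≡ w x y
        w*δ≡w = trans (cong (w x y *_) (δ-refl (f x y))) (ℕₚ.*-identityʳ (w x y))
      ... | no  f≢c  = sym (trans (cong (λ k → ℕ→ℚ k ℚ.* ρ) w*δ≡0) (ℚₚ.*-zeroˡ ρ))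
        where
        w*δ≡0 : w x y * δ (f x y) c ≡ 0
        w*δ≡0 = trans (cong (w x y *_) (δ-≢ (f x y) c f≢c)) (ℕₚ.*-zeroʳ (w x y))

-- Uniform distribution on the fibre of a popular prefix

module PopularPrefix {n α k : ℕ} (f : Bits n → Bits n → Bits (α + k)) where

  prefix : Bits n → Bits n → Bits α
  prefix x y = take α (f x y)

  suffix : Bits n → Bits n → Bits k
  suffix x y = drop α (f x y)

  p : Bits α
  p = proj₁ (pigeonhole (pairs n) α (uncurry prefix) (λ _ → 1))

  fibre : Bits n → Bits n → ℕ
  fibre x y = δ (prefix x y) p

  2ⁿ*2ⁿ≤Σ²fibre*2^α : 2 ^ n * 2 ^ n ≤ Σ² fibre * 2 ^ α
  2ⁿ*2ⁿ≤Σ²fibre*2^α = begin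
    2 ^ n * 2 ^ n                                           ≡⟨ length-pairs n ⟨
    length (pairs n)                                        ≡⟨ ℕₚ.*-identityʳ _ ⟨
    length (pairs n) * 1                                    ≡⟨ ∑-const (pairs n) 1 ⟨
    ∑ (pairs n) (λ _ → 1)                                   ≤⟨ proj₂ (pigeonhole (pairs n) α (uncurry prefix) (λ _ → 1)) ⟩
    ∑ (pairs n) (λ a → 1 * δ (uncurry prefix a) p) * 2 ^ α  ≡⟨ cong (_* 2 ^ α) (∑-cong (pairs n) 1*δ≡δ) ⟩
    Σ² fibre * 2 ^ α                                        ∎
    where
    open ℕₚ.≤-Reasoning
    1*δ≡δ : ∀ a → 1 * δ (uncurry prefix a) p ≡ uncurry fibre a
    1*δ≡δ a = ℕₚ.*-identityˡ (uncurry fibre a)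

  ≤2ⁿ*2ⁿ⇒≤2^α*Σ²fibre : ∀ {R} → R ≤ 2 ^ n * 2 ^ n → R ≤ 2 ^ α * Σ² fibre
  ≤2ⁿ*2ⁿ⇒≤2^α*Σ²fibre R≤ =
    ℕₚ.≤-trans R≤ (ℕₚ.≤-trans 2ⁿ*2ⁿ≤Σ²fibre*2^α (ℕₚ.≤-reflexive (ℕₚ.*-comm (Σ² fibre) (2 ^ α))))

  instance
    Σ²fibre-nonZero : NonZero (Σ² fibre)
    Σ²fibre-nonZero = ℕₚ.m*n≢0⇒m≢0 (Σ² fibre) {{>-nonZero (ℕₚ.<-≤-trans 2ⁿ*2ⁿ>0 2ⁿ*2ⁿ≤Σ²fibre*2^α)}}
      where 2ⁿ*2ⁿ>0 : 0 < 2 ^ n * 2 ^ n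
            2ⁿ*2ⁿ>0 = ℕₚ.*-mono-≤ (ℕₚ.m^n>0 2 n) (ℕₚ.m^n>0 2 n)

  s : Bits k
  s = proj₁ (pigeonhole (pairs n) k (uncurry suffix) (uncurry fibre))

  c : Bits (α + k)
  c = p Vec.++ s

  hits : Bits (α + k) → ℕ
  hits c′ = Σ² (λ x y → fibre x y * δ (f x y) c′)

  fibre*δ-suffix : ∀ x y → fibre x y * δ (suffix x y) s ≡ fibre x y * δ (f x y) c
  fibre*δ-suffix x y = begin
    φ * δ (suffix x y) s        ≡⟨ cong (_* δ (suffix x y) s) (δ-idem (prefix x y) p) ⟨
    φ * φ * δ (suffix x y) s    ≡⟨ ℕₚ.*-assoc φ φ (δ (suffix x y) s) ⟩
    φ * (φ * δ (suffix x y) s)  ≡⟨ cong (φ *_) (δ-take-drop α (f x y) p s) ⟨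
    φ * δ (f x y) c             ∎
    where
    open ≡-Reasoning
    φ : ℕ
    φ = fibre x y

  Σ²fibre≤hits*2^k : Σ² fibre ≤ hits c * 2 ^ k
  Σ²fibre≤hits*2^k = subst (λ M → Σ² fibre ≤ M * 2 ^ k) (∑-cong (pairs n) (uncurry fibre*δ-suffix))
                           (proj₂ (pigeonhole (pairs n) k (uncurry suffix) (uncurry fibre)))

  open WeightedDistribution fibre public

  minEntropy-X : MinEntropy≥ (PrX dist) n α
  minEntropy-X = counts⇒minEntropy≥ (λ a → ∑ (allBits n) (fibre a)) n α PrX-dist
    (λ a → ≤2ⁿ*2ⁿ⇒≤2^α*Σ²fibre (ℕₚ.*-monoˡ-≤ (2 ^ n) (∑-allBits-≤ n (λ b → δ≤1 (prefix a b) p))))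

  minEntropy-Y : MinEntropy≥ (PrY dist) n α
  minEntropy-Y = counts⇒minEntropy≥ (λ b → ∑ (allBits n) (λ a → fibre a b)) n α PrY-dist
    (λ b → ≤2ⁿ*2ⁿ⇒≤2^α*Σ²fibre (ℕₚ.*-monoˡ-≤ (2 ^ n) (∑-allBits-≤ n (λ a → δ≤1 (prefix a b) p))))

  minEntropy-XY : MinEntropy≥ (PrXY dist) (n + n) α
  minEntropy-XY = counts⇒minEntropy≥ (uncurry fibre) (n + n) α (λ _ → refl)
    (λ (a , b) → ≤2ⁿ*2ⁿ⇒≤2^α*Σ²fibre (begin
      fibre a b * 2 ^ (n + n)  ≤⟨ ℕₚ.*-monoˡ-≤ (2 ^ (n + n)) (δ≤1 (prefix a b) p) ⟩
      1 * 2 ^ (n + n)          ≡⟨ ℕₚ.*-identityˡ (2 ^ (n + n)) ⟩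
      2 ^ (n + n)              ≡⟨ ℕₚ.^-distribˡ-+-* 2 n n ⟩
      2 ^ n * 2 ^ n            ∎))
    where open ℕₚ.≤-Reasoning

  minEntropy-f : MinEntropy≤ (PrF f dist) (α + k) α
  minEntropy-f = count⇒minEntropy≤ {p = PrF f dist} hits (α + k) α c (PrF-dist f c) (begin
    2 ^ α * Σ² fibre         ≤⟨ ℕₚ.*-monoʳ-≤ (2 ^ α) Σ²fibre≤hits*2^k ⟩
    2 ^ α * (hits c * 2 ^ k) ≡⟨ x∙yz≈y∙xz ℕₚ.*-commutativeSemigroup (2 ^ α) (hits c) (2 ^ k) ⟩
    hits c * (2 ^ α * 2 ^ k) ≡⟨ cong (hits c *_) (ℕₚ.^-distribˡ-+-* 2 α k) ⟨
    hits c * 2 ^ (α + k)     ∎)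
    where open ℕₚ.≤-Reasoning

theorem3 : (n m : ℕ) (f : Bits n → Bits n → Bits m) (α : ℕ) → α ≤ m →
    Σ (JointDist n) (λ D →
      MinEntropy≥ (PrX D) n α ×
      MinEntropy≥ (PrY D) n α ×
      MinEntropy≥ (PrXY D) (n + n) α ×
      MinEntropy≤ (PrF f D) m α)
theorem3 n m f α α≤m with ℕₚ.m≤n⇒∃[o]m+o≡n α≤m
... | k , refl = dist , minEntropy-X , minEntropy-Y , minEntropy-XY , minEntropy-f
  where open PopularPrefix {α = α} {k} f
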